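{- Let $W_{\Delta,n}$ be a Knödel graph with $\Delta\ge3$ and $n\ge(2\Delta-5)(2^{\Delta}-2)+4$, and let $s=2^{\Delta-1}-1$. Then \[\operatorname{diam}(W_{\Delta,n})=\max\left\{d\big(u_0,u_{\lfloor n/4\rfloor}\big),\ d\big(u_0,v_{\lfloor (n+2s)/4\rfloor}\big)\right\}.\]
   Context: Knödel graph: for an even integer $n$ and an integer $\Delta$ with $1\le\Delta\le\lfloor\log_2 n\rfloor$, $W_{\Delta,n}$ is the simple bipartite graph with vertex set $U\cup V$, $U=\{u_0,\dots,u_{n/2-1}\}$, $V=\{v_0,\dots,v_{n/2-1}\}$; indices are read modulo $n/2$. The vertices $u_i$ and $v_j$ are adjacent iff $j-i\equiv 2^k-1\pmod{n/2}$ for some $k\in\{0,\dots,\Delta-1\}$; no other edges. $d$ is the graph distance and $\operatorname{diam}$ the diameter. -}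

module Defs where

open import Data.Nat using (ℕ; zero; suc; _+_; _*_; _∸_; _^_; _≤_; _<_; _⊔_; _/_; _%_; NonZero)
open import Data.Fin using (Fin; toℕ; fromℕ<)
open import Data.Nat.DivMod using (m%n<n)
open import Data.Product using (Σ; ∃; ∃-syntax; _×_; _,_)
open import Relation.Binary.PropositionalEquality using (_≡_)

-- The Knödel graph W_{Δ,n} with n = 2 * m (m = n/2).
-- A vertex is a side (U or V) together with an index in Fin m.
data Side : Set where
  U V : Side

Vertex : ℕ → Set
Vertex m = Side × Fin m

KRel : (Δ m : ℕ) → .{{_ : NonZero m}} → Fin m → Fin m → Set
KRel Δ m i j = ∃[ k ] (k < Δ × (toℕ i + (2 ^ k ∸ 1)) % m ≡ toℕ j)

data Adj (Δ m : ℕ) .{{_ : NonZero m}} : Vertex m → Vertex m → Set where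
  uv : ∀ {i j} → KRel Δ m i j → Adj Δ m (U , i) (V , j)
  vu : ∀ {i j} → KRel Δ m i j → Adj Δ m (V , j) (U , i)

data Walk (Δ m : ℕ) .{{_ : NonZero m}} : Vertex m → Vertex m → ℕ → Set where
  here : ∀ {x} → Walk Δ m x x 0
  step : ∀ {x y z L} → Adj Δ m x y → Walk Δ m y z L → Walk Δ m x z (suc L)

IsDist : (Δ m : ℕ) → .{{_ : NonZero m}} → Vertex m → Vertex m → ℕ → Set
IsDist Δ m x y D = Walk Δ m x y D × (∀ L → Walk Δ m x y L → D ≤ L)

IsDiam : (Δ m : ℕ) → .{{_ : NonZero m}} → ℕ → Set
IsDiam Δ m D = (∀ x y → ∃[ L ] (L ≤ D × IsDist Δ m x y L))
             × (∃[ x ] ∃[ y ] IsDist Δ m x y D)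

uₙ vₙ : (m : ℕ) → .{{_ : NonZero m}} → ℕ → Vertex m
uₙ m i = U , fromℕ< (m%n<n i m)
vₙ m i = V , fromℕ< (m%n<n i m)

module Submission where

-- An edge joins u_i to v_{i + offset a} (indices mod m), offset a = 2^a - 1, a ≤ k.
-- Two consecutive edges shift an index by a "gap" offset a - offset b, so a walk of
-- length 2c shifts it by a sum of c gaps, and one more edge adds an offset.
-- Upper bound: by the representation theorem ('representable', proved by doubling
-- along k), for c ≥ k - 1 every y ≤ c·s is a sum of exactly c gaps.  So vertices on
-- one side are joined by walks of length 2c₁, and u, v by walks of length 2c₂ + 1,
-- where c₁, c₂ are least with ⌊n/4⌋ ≤ c₁·s and ⌊(n+2s)/4⌋ ≤ (c₂+1)·s; the size
-- hypothesis on n gives c₁, c₂ ≥ k - 1.  Lower bound: an edge moves an index by at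
-- most s, so u_{⌊n/4⌋} and v_{⌊(n+2s)/4⌋} are at distance exactly 2c₁ and 2c₂ + 1.

open import Defs
open import Data.Nat using (ℕ; zero; suc; _+_; _*_; _∸_; _^_; _≤_; _<_; _⊔_; _/_; _%_; NonZero;
  _≤′_; ≤′-reflexive; ≤′-step; z≤n; s≤s; s≤s⁻¹; _≤?_; _<?_)
open import Data.Nat.Properties
open import Data.Nat.DivMod using (m≡m%n+[m/n]*n; m%n<n; m%n≤m; m%n%n≡m%n; m*n/m*o≡n/o;
  %-distribˡ-+; [m+n]%n≡m%n; [m+kn]%n≡m%n; m<n⇒m%n≡m; m≤n⇒[n∸m]%m≡n%m)
open import Data.Nat.Induction using (<-rec)
open import Data.Nat.Tactic.RingSolver using (solve-∀)
open import Data.Fin using (Fin; toℕ; fromℕ<)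
import Data.Fin.Properties as Fin
open import Data.Product using (∃-syntax; _×_; _,_; proj₁; proj₂)
open import Data.Product.Properties using (≡-dec)
open import Data.Sum using (_⊎_; inj₁; inj₂)
open import Function using (_∘_)
open import Relation.Nullary using (Dec; yes; no)
open import Relation.Nullary.Decidable using (map′; _×-dec_)
open import Relation.Binary.Definitions using (DecidableEquality)
open import Relation.Unary using (Decidable)
open import Relation.Binary.PropositionalEquality

record Least (P : ℕ → Set) : Set where
  field
    value   : ℕ
    holds   : P value
    minimal : ∀ n → P n → value ≤ n

least : ∀ {P : ℕ → Set} → Decidable P → ∀ n → P n → Least P
least {P} P? = <-rec (λ n → P n → Least P) search
  where
  search : ∀ n → (∀ {k} → k < n → P k → Least P) → P n → Least P
  search n smaller Pn with anyUpTo? P? n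
  ... | yes (k , k<n , Pk) = smaller k<n Pk
  ... | no  none           = record
    { value = n ; holds = Pn ; minimal = λ k Pk → ≮⇒≥ (λ k<n → none (k , k<n , Pk)) }

-- offset a = 2^a - 1, the index shift along an edge of dimension a; the recursive
-- form offset (a + 1) = 2·offset a + 1 is the one used in the doubling argument.
offset : ℕ → ℕ
offset zero    = 0
offset (suc a) = suc (offset a + offset a)

suc-offset : ∀ a → suc (offset a) ≡ 2 ^ a
suc-offset zero    = refl
suc-offset (suc a) = begin
  suc (suc (offset a + offset a))    ≡⟨ cong suc (+-suc (offset a) (offset a)) ⟨
  suc (offset a) + suc (offset a)    ≡⟨ cong₂ _+_ (suc-offset a) (suc-offset a) ⟩
  2 ^ a + 2 ^ a                      ≡⟨ cong (2 ^ a +_) (+-identityʳ (2 ^ a)) ⟨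
  2 ^ suc a                          ∎
  where open ≡-Reasoning

offset≡ : ∀ a → offset a ≡ 2 ^ a ∸ 1
offset≡ a = cong (_∸ 1) (suc-offset a)

offset-mono : ∀ {a b} → a ≤ b → offset a ≤ offset b
offset-mono z≤n       = z≤n
offset-mono (s≤s a≤b) = s≤s (+-mono-≤ (offset-mono a≤b) (offset-mono a≤b))

-- With c ≥ k - 1 the intervals [0, c·s] and [s, (c+1)·s] (s = offset k) overlap,
-- so [0, (c+1)·s] is covered by "c·s or less" and "s plus c·s or less".
ranges-overlap : ∀ {k c} → k ≤ suc c → offset k ≤ suc (c * offset k)
ranges-overlap {zero}        {zero}  _        = z≤n
ranges-overlap {suc zero}    {zero}  _        = s≤s z≤n
ranges-overlap {suc (suc k)} {zero}  (s≤s ())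
ranges-overlap {k}           {suc c} _        = ≤-trans (m≤m+n (offset k) (c * offset k)) (n≤1+n _)

split-range : ∀ {s c y} → s ≤ suc (c * s) → y ≤ s + c * s → y ≤ c * s ⊎ (s ≤ y × y ∸ s ≤ c * s)
split-range {s} {c} {y} s≤ y≤ with y ≤? c * s
... | yes y≤cs = inj₁ y≤cs
... | no  y≰cs = inj₂ (s≤y , ≤-trans (∸-monoˡ-≤ s y≤) (≤-reflexive (m+n∸m≡n s (c * s))))
  where
  s≤y : s ≤ y
  s≤y = ≤-trans s≤ (≰⇒> y≰cs)

-- t is a gap of level k: a difference offset a - offset b of two edge offsets with
-- a, b ≤ k.  Two edges u_x – v_{x + offset a} – u_{x + t} realise it.
Gap : ℕ → ℕ → Set
Gap k t = ∃[ a ] ∃[ b ] (a ≤ k × b ≤ k × t + offset b ≡ offset a)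

gap-zero : ∀ {k} → Gap k 0
gap-zero = 0 , 0 , z≤n , z≤n , refl

gap-one : ∀ {k} → Gap (suc k) 1
gap-one = 1 , 0 , s≤s z≤n , z≤n , refl

gap-full : ∀ {k} → Gap k (offset k)
gap-full {k} = k , 0 , ≤-refl , z≤n , +-identityʳ (offset k)

gap-full-even : ∀ {k} → Gap (suc k) (offset k + offset k)
gap-full-even {k} = suc k , 1 , ≤-refl , s≤s z≤n , +-comm (offset k + offset k) 1

gap-double : ∀ {k t} → Gap k t → Gap (suc k) (t + t)
gap-double {t = t} (a , b , a≤k , b≤k , e) =
  suc a , suc b , s≤s a≤k , s≤s b≤k , trans (regroup t (offset b)) (cong (λ x → suc (x + x)) e)
  where
  regroup : ∀ t o → t + t + suc (o + o) ≡ suc ((t + o) + (t + o))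
  regroup = solve-∀

data GapSum (k : ℕ) : ℕ → ℕ → Set where
  []  : GapSum k 0 0
  _∷_ : ∀ {t c y} → Gap k t → GapSum k c y → GapSum k (suc c) (t + y)

double : ∀ {k c y} → GapSum k c y → GapSum (suc k) c (y + y)
double []                   = []
double (_∷_ {t} {y = y} g r) = subst (GapSum _ _) (interchange t y) (gap-double g ∷ double r)
  where
  interchange : ∀ t y → t + t + (y + y) ≡ t + y + (t + y)
  interchange = solve-∀

Complete : ℕ → ℕ → Set
Complete k c = ∀ y → y ≤ c * offset k → GapSum k c y

extend : ∀ {k c} → k ≤ suc c → Complete k c → Complete k (suc c)
extend {k} {c} k≤1+c complete y y≤ with split-range {c = c} (ranges-overlap {k} {c} k≤1+c) y≤
... | inj₁ y≤cs         = gap-zero ∷ complete y y≤cs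
... | inj₂ (s≤y , rest) = subst (GapSum k (suc c)) (m+[n∸m]≡n s≤y) (gap-full ∷ complete (y ∸ offset k) rest)

-- The top of the range at level k + 1 (offset = 2·o + 1 with o = offset k):
-- n·2o + f with f ≤ n is f gaps 2o + 1 plus n - f gaps 2o.
top-range : ∀ {k} n f → f ≤ n → GapSum (suc k) n (n * (offset k + offset k) + f)
top-range     zero    zero    z≤n       = []
top-range {k} (suc n) zero    z≤n       =
  subst (GapSum (suc k) (suc n)) (shift (offset k + offset k) (n * _)) (gap-full-even ∷ top-range n 0 z≤n)
  where
  shift : ∀ d x → d + (x + 0) ≡ d + x + 0
  shift = solve-∀
top-range {k} (suc n) (suc f) (s≤s f≤n) =
  subst (GapSum (suc k) (suc n)) (shift (offset k) (n * _) f) (gap-full ∷ top-range n f f≤n)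
  where
  shift : ∀ o x f → suc (o + o) + (x + f) ≡ o + o + x + suc f
  shift = solve-∀

data Parity : ℕ → Set where
  even : ∀ z → Parity (z + z)
  odd  : ∀ z → Parity (suc (z + z))

parity : ∀ y → Parity y
parity zero = even 0
parity (suc y) with parity y
... | even z = odd z
... | odd  z = subst Parity (cong suc (+-suc z z)) (even (suc z))

halve-< : ∀ {z x} → z + z < x + x → z < x
halve-< lt = ≰⇒> (λ x≤z → <⇒≱ lt (+-mono-≤ x≤z x≤z))

-- At level k + 1 with n + 1 gaps:
-- the top of the range is handled by 'top-range'; below it an even 2z is the double
-- of a representation of z with n + 1 gaps at level k, and an odd 2z + 1 is 1 plus
-- the double of z, or 2s + 1 plus the double of z - s, with n gaps at level k.
double-step : ∀ {k n} → k ≤ suc n → Complete k n → Complete (suc k) (suc n)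
double-step {k} {n} k≤1+n complete y y≤ with suc n * (offset k + offset k) ≤? y
... | yes low≤y = subst (GapSum (suc k) (suc n)) (m+[n∸m]≡n low≤y) (top-range (suc n) (y ∸ low) f≤)
  where
  low = suc n * (offset k + offset k)
  f≤ : y ∸ low ≤ suc n
  f≤ = ≤-trans (∸-monoˡ-≤ low (≤-trans y≤ (≤-reflexive (*-suc (suc n) _))))
               (≤-reflexive (m+n∸n≡m (suc n) low))
... | no  y≮low = by-parity y (parity y) (≰⇒> y≮low)
  where
  s = offset k
  below : ∀ {z} → z + z < suc n * (s + s) → z ≤ suc n * s
  below lt = <⇒≤ (halve-< (≤-trans lt (≤-reflexive (*-distribˡ-+ (suc n) s s))))
  recombine : ∀ {z} → s ≤ z → suc (s + s) + ((z ∸ s) + (z ∸ s)) ≡ suc (z + z)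
  recombine {z} s≤z = trans (regroup s (z ∸ s)) (cong (λ x → suc (x + x)) (m+[n∸m]≡n s≤z))
    where
    regroup : ∀ s w → suc (s + s) + (w + w) ≡ suc ((s + w) + (s + w))
    regroup = solve-∀
  by-parity : ∀ y → Parity y → y < suc n * (s + s) → GapSum (suc k) (suc n) y
  by-parity _ (even z) lt = double (extend k≤1+n complete z (below lt))
  by-parity _ (odd z)  lt with split-range {c = n} (ranges-overlap k≤1+n) (below (<-trans (n<1+n _) lt))
  ... | inj₁ z≤ns          = gap-one ∷ double (complete z z≤ns)
  ... | inj₂ (s≤z , w≤ns)  = subst (GapSum (suc k) (suc n)) (recombine s≤z)
                                   (gap-full ∷ double (complete (z ∸ s) w≤ns))

complete : ∀ L → Complete (suc L) L
complete zero    .0 z≤n = []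
complete (suc L) = double-step ≤-refl (complete L)

representable : ∀ {L c y} → L ≤ c → y ≤ c * offset (suc L) → GapSum (suc L) c y
representable {L} L≤c = go (≤⇒≤′ L≤c) _
  where
  go : ∀ {c} → L ≤′ c → Complete (suc L) c
  go (≤′-reflexive refl) = complete L
  go (≤′-step L≤′c)      = extend (s≤s (≤′⇒≤ L≤′c)) (go L≤′c)

complement : ∀ {m a b δ} → m ≤ suc (a + b) → a < δ → m ∸ δ ≤ b
complement {m} {a} {b} {δ} m≤ a<δ =
  ≤-trans (∸-monoˡ-≤ δ (≤-trans m≤ (+-monoˡ-≤ b a<δ))) (≤-reflexive (m+n∸m≡n δ b))

IsHalf : ℕ → ℕ → Set
IsHalf x y = y + y ≤ x × x ≤ suc (y + y)

-- ⌊2x/4⌋ = ⌊x/2⌋; this is how ⌊n/4⌋ and ⌊(n+2s)/4⌋ enter with n = 2m.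
halving : ∀ x → IsHalf x ((2 * x) / 4)
halving x = subst (IsHalf x) (sym (m*n/m*o≡n/o 2 x 2)) (lower , upper)
  where
  open ≤-Reasoning
  q = x / 2
  r = x % 2
  twice : q * 2 ≡ q + q
  twice = trans (*-comm q 2) (cong (q +_) (+-identityʳ q))
  lower : q + q ≤ x
  lower = begin
    q + q       ≡⟨ twice ⟨
    q * 2       ≤⟨ m≤n+m (q * 2) r ⟩
    r + q * 2   ≡⟨ m≡m%n+[m/n]*n x 2 ⟨
    x           ∎
  upper : x ≤ suc (q + q)
  upper = begin
    x           ≡⟨ m≡m%n+[m/n]*n x 2 ⟩
    r + q * 2   ≤⟨ +-mono-≤ (s≤s⁻¹ (m%n<n x 2)) (≤-reflexive twice) ⟩
    1 + (q + q) ∎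

module Walks (Δ m : ℕ) .{{_ : NonZero m}} where

  _++_ : ∀ {x y z L L′} → Walk Δ m x y L → Walk Δ m y z L′ → Walk Δ m x z (L + L′)
  here     ++ w′ = w′
  step a w ++ w′ = step a (w ++ w′)

  adj-sym : ∀ {x y} → Adj Δ m x y → Adj Δ m y x
  adj-sym (uv r) = vu r
  adj-sym (vu r) = uv r

  snoc : ∀ {x y z L} → Walk Δ m x y L → Adj Δ m y z → Walk Δ m x z (suc L)
  snoc here       a = step a here
  snoc (step b w) a = step b (snoc w a)

  reverse : ∀ {x y L} → Walk Δ m x y L → Walk Δ m y x L
  reverse here       = here
  reverse (step a w) = snoc (reverse w) (adj-sym a)

  side-≟ : DecidableEquality Side
  side-≟ U U = yes refl
  side-≟ V V = yes refl
  side-≟ U V = no λ ()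
  side-≟ V U = no λ ()

  related? : ∀ i j → Dec (KRel Δ m i j)
  related? i j = anyUpTo? (λ a → (toℕ i + (2 ^ a ∸ 1)) % m ≟ toℕ j) Δ

  adj? : ∀ x y → Dec (Adj Δ m x y)
  adj? (U , i) (V , j) = map′ uv (λ { (uv r) → r }) (related? i j)
  adj? (V , j) (U , i) = map′ vu (λ { (vu r) → r }) (related? i j)
  adj? (U , _) (U , _) = no λ ()
  adj? (V , _) (V , _) = no λ ()

  walk? : ∀ L x y → Dec (Walk Δ m x y L)
  walk? zero x y with ≡-dec side-≟ Fin._≟_ x y
  ... | yes refl = yes here
  ... | no  x≢y  = no λ { here → x≢y refl }
  walk? (suc L) x y with Fin.any? (λ i → adj? x (U , i) ×-dec walk? L (U , i) y)
                       | Fin.any? (λ i → adj? x (V , i) ×-dec walk? L (V , i) y)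
  ... | yes (_ , a , w) | _               = yes (step a w)
  ... | no _            | yes (_ , a , w) = yes (step a w)
  ... | no viaU         | no viaV         = no λ
    { (step {y = U , i} a w) → viaU (i , a , w)
    ; (step {y = V , i} a w) → viaV (i , a , w) }

  distance : ∀ {x y L} → Walk Δ m x y L → ∃[ D ] (D ≤ L × IsDist Δ m x y D)
  distance {x} {y} {L} w = value , minimal L w , holds , minimal
    where open Least (least (λ n → walk? n x y) L w)

  diameter : ∀ {x₁ y₁ x₂ y₂ d₁ d₂} → (∀ x y → ∃[ L ] (L ≤ d₁ ⊔ d₂ × Walk Δ m x y L)) →
             IsDist Δ m x₁ y₁ d₁ → IsDist Δ m x₂ y₂ d₂ → IsDiam Δ m (d₁ ⊔ d₂)
  diameter {d₁ = d₁} {d₂} walks dist₁ dist₂ = all-close , farthest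
    where
    all-close : ∀ x y → ∃[ L ] (L ≤ d₁ ⊔ d₂ × IsDist Δ m x y L)
    all-close x y with walks x y
    ... | L , L≤ , w with distance w
    ...   | D , D≤L , dist = D , ≤-trans D≤L L≤ , dist
    farthest : ∃[ x ] ∃[ y ] IsDist Δ m x y (d₁ ⊔ d₂)
    farthest with ⊔-sel d₁ d₂
    ... | inj₁ e = _ , _ , subst (IsDist Δ m _ _) (sym e) dist₁
    ... | inj₂ e = _ , _ , subst (IsDist Δ m _ _) (sym e) dist₂

module Shifts (k m : ℕ) .{{_ : NonZero m}} where
  open Walks (suc k) m

  ⟦_⟧ : ℕ → Fin m
  ⟦ x ⟧ = fromℕ< (m%n<n x m)

  toℕ-⟦⟧ : ∀ x → toℕ ⟦ x ⟧ ≡ x % m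
  toℕ-⟦⟧ x = Fin.toℕ-fromℕ< (m%n<n x m)

  ⟦⟧-cong : ∀ {x y} → x % m ≡ y % m → ⟦ x ⟧ ≡ ⟦ y ⟧
  ⟦⟧-cong {x} {y} e = Fin.toℕ-injective (trans (toℕ-⟦⟧ x) (trans e (sym (toℕ-⟦⟧ y))))

  ⟦toℕ⟧ : ∀ i → ⟦ toℕ i ⟧ ≡ i
  ⟦toℕ⟧ i = Fin.toℕ-injective (trans (toℕ-⟦⟧ (toℕ i)) (m<n⇒m%n≡m (Fin.toℕ<n i)))

  %-absorbˡ : ∀ x y → (x % m + y) % m ≡ (x + y) % m
  %-absorbˡ x y = begin
    (x % m + y) % m            ≡⟨ %-distribˡ-+ (x % m) y m ⟩
    (x % m % m + y % m) % m    ≡⟨ cong (λ r → (r + y % m) % m) (m%n%n≡m%n x m) ⟩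
    (x % m + y % m) % m        ≡⟨ %-distribˡ-+ x y m ⟨
    (x + y) % m                ∎
    where open ≡-Reasoning

  mod-step : ∀ {x} t → x < m → (x + t) % m ≡ x + t ⊎ (x + t) % m + m ≤ x + t
  mod-step {x} t x<m with x + t <? m
  ... | yes small = inj₁ (m<n⇒m%n≡m small)
  ... | no  large = inj₂ (≤-trans (+-monoˡ-≤ m reduced) (≤-reflexive (m∸n+n≡m (≮⇒≥ large))))
    where
    reduced : (x + t) % m ≤ x + t ∸ m
    reduced = ≤-trans (≤-reflexive (sym (m≤n⇒[n∸m]%m≡n%m (≮⇒≥ large)))) (m%n≤m (x + t ∸ m) m)

  edge : ∀ {a x y} → a ≤ k → (x + offset a) % m ≡ y % m → Adj (suc k) m (U , ⟦ x ⟧) (V , ⟦ y ⟧)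
  edge {a} {x} {y} a≤k e = uv (a , s≤s a≤k , (begin
    (toℕ ⟦ x ⟧ + (2 ^ a ∸ 1)) % m  ≡⟨ cong₂ (λ r t → (r + t) % m) (toℕ-⟦⟧ x) (sym (offset≡ a)) ⟩
    (x % m + offset a) % m          ≡⟨ %-absorbˡ x (offset a) ⟩
    (x + offset a) % m              ≡⟨ e ⟩
    y % m                           ≡⟨ toℕ-⟦⟧ y ⟨
    toℕ ⟦ y ⟧                       ∎))
    where open ≡-Reasoning

  retarget : ∀ {S S′ i i′ j j′ L} → i ≡ i′ → j ≡ j′ →
             Walk (suc k) m (S , i) (S′ , j) L → Walk (suc k) m (S , i′) (S′ , j′) L
  retarget refl refl w = w

  -- A gap of level k shifts an index by two steps on either side: on U via the
  -- V-vertex x + offset a, on V via the U-vertex p ≡ x - offset b (mod m).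
  gap-walk : ∀ S {t} → Gap k t → ∀ x → Walk (suc k) m (S , ⟦ x ⟧) (S , ⟦ x + t ⟧) 2
  gap-walk U {t} (a , b , a≤k , b≤k , e) x =
    step (edge a≤k refl) (step (adj-sym (edge b≤k (cong (_% m) meet))) here)
    where
    meet : x + t + offset b ≡ x + offset a
    meet = trans (+-assoc x t (offset b)) (cong (x +_) e)
  gap-walk V {t} (a , b , a≤k , b≤k , e) x =
    step (adj-sym (edge b≤k (lands (offset b) x p+b)))
         (step (edge a≤k (lands (offset a) (x + t) shifted)) here)
    where
    back = offset b * m ∸ offset b
    p = x + back
    p+b : p + offset b ≡ x + offset b * m
    p+b = trans (+-assoc x back (offset b)) (cong (x +_) (m∸n+n≡m (m≤m*n (offset b) m)))
    shifted : p + offset a ≡ x + t + offset b * m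
    shifted = begin
      p + offset a               ≡⟨ cong (p +_) e ⟨
      p + (t + offset b)         ≡⟨ swap p t (offset b) ⟩
      p + offset b + t           ≡⟨ cong (_+ t) p+b ⟩
      x + offset b * m + t       ≡⟨ reorder x (offset b * m) t ⟩
      x + t + offset b * m       ∎
      where
      open ≡-Reasoning
      swap : ∀ u v w → u + (v + w) ≡ u + w + v
      swap = solve-∀
      reorder : ∀ u v w → u + v + w ≡ u + w + v
      reorder = solve-∀
    lands : ∀ o z → p + o ≡ z + offset b * m → (p + o) % m ≡ z % m
    lands o z eq = trans (cong (_% m) eq) ([m+kn]%n≡m%n z (offset b) m)

  shift-walk : ∀ S {c y} → GapSum k c y → ∀ x → Walk (suc k) m (S , ⟦ x ⟧) (S , ⟦ x + y ⟧) (c + c)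
  shift-walk S []                     x = retarget refl (cong ⟦_⟧ (sym (+-identityʳ x))) here
  shift-walk S (_∷_ {t} {c} {y} g gs) x =
    subst₂ (λ z L → Walk (suc k) m (S , ⟦ x ⟧) (S , ⟦ z ⟧) L) (+-assoc x t y) (cong suc (sym (+-suc c c)))
           (gap-walk S g x ++ shift-walk S gs (x + t))

  displacement : ∀ (i j : Fin m) → ∃[ δ ] (δ < m × ⟦ toℕ i + δ ⟧ ≡ j)
  displacement i j = (m ∸ toℕ i + toℕ j) % m , m%n<n _ m , trans (⟦⟧-cong lands) (⟦toℕ⟧ j)
    where
    open ≡-Reasoning
    lands : (toℕ i + (m ∸ toℕ i + toℕ j) % m) % m ≡ toℕ j % m
    lands = begin
      (toℕ i + (m ∸ toℕ i + toℕ j) % m) % m   ≡⟨ cong (_% m) (+-comm (toℕ i) _) ⟩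
      ((m ∸ toℕ i + toℕ j) % m + toℕ i) % m   ≡⟨ %-absorbˡ (m ∸ toℕ i + toℕ j) (toℕ i) ⟩
      (m ∸ toℕ i + toℕ j + toℕ i) % m         ≡⟨ cong (_% m) (reorder (m ∸ toℕ i) (toℕ j) (toℕ i)) ⟩
      (m ∸ toℕ i + toℕ i + toℕ j) % m         ≡⟨ cong (λ r → (r + toℕ j) % m) (m∸n+n≡m (<⇒≤ (Fin.toℕ<n i))) ⟩
      (m + toℕ j) % m                         ≡⟨ cong (_% m) (+-comm m (toℕ j)) ⟩
      (toℕ j + m) % m                         ≡⟨ [m+n]%n≡m%n (toℕ j) m ⟩
      toℕ j % m                               ∎
      where
      reorder : ∀ u v w → u + v + w ≡ u + w + v
      reorder = solve-∀

  wrap-around : ∀ {x δ y} {j : Fin m} → ⟦ x + δ ⟧ ≡ j → δ + y ≡ m → ⟦ toℕ j + y ⟧ ≡ ⟦ x ⟧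
  wrap-around {x} {δ} {y} refl δ+y≡m = ⟦⟧-cong (begin
    (toℕ ⟦ x + δ ⟧ + y) % m      ≡⟨ cong (λ r → (r + y) % m) (toℕ-⟦⟧ (x + δ)) ⟩
    ((x + δ) % m + y) % m        ≡⟨ %-absorbˡ (x + δ) y ⟩
    (x + δ + y) % m              ≡⟨ cong (_% m) (trans (+-assoc x δ y) (cong (x +_) δ+y≡m)) ⟩
    (x + m) % m                  ≡⟨ [m+n]%n≡m%n x m ⟩
    x % m                        ∎)
    where open ≡-Reasoning

module Bounds (L m : ℕ) .{{_ : NonZero m}} where
  open Walks (suc (suc L)) m
  open Shifts (suc L) m

  s : ℕ
  s = offset (suc L)

  edge-0 : ∀ x → Adj (suc (suc L)) m (U , ⟦ x ⟧) (V , ⟦ x ⟧)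
  edge-0 x = edge z≤n (cong (_% m) (+-identityʳ x))

  -- Upper bound on one side: if L ≤ c and m ≤ 2c·s + 1, any two vertices of the same
  -- side are joined by a walk of length 2c (shift forward by δ or backward by m - δ).
  same-side : ∀ S c → L ≤ c → m ≤ suc (c * s + c * s) →
              ∀ i j → Walk (suc (suc L)) m (S , i) (S , j) (c + c)
  same-side S c L≤c m≤ i j with displacement i j
  ... | δ , δ<m , lands with δ ≤? c * s
  ...   | yes δ≤ = retarget (⟦toℕ⟧ i) lands (shift-walk S (representable L≤c δ≤) (toℕ i))
  ...   | no  δ≰ = reverse (retarget (⟦toℕ⟧ j) (trans (wrap-around lands (m+[n∸m]≡n (<⇒≤ δ<m))) (⟦toℕ⟧ i))
                             (shift-walk S (representable L≤c (complement m≤ (≰⇒> δ≰))) (toℕ j)))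

  -- Upper bound across the sides: if L ≤ c and m ≤ (2c+1)·s + 1, any u_i and v_j are
  -- joined by a walk of length 2c + 1 (a shift followed by an edge of offset 0 or s).
  cross : ∀ c → L ≤ c → m ≤ suc (suc c * s + c * s) →
          ∀ i j → Walk (suc (suc L)) m (U , i) (V , j) (suc (c + c))
  cross c L≤c m≤ i j with displacement i j
  ... | δ , δ<m , lands with δ ≤? suc c * s
  ...   | no  δ≰ = reverse (retarget (⟦toℕ⟧ j) (⟦toℕ⟧ i)
                     (snoc (retarget refl (wrap-around lands (m+[n∸m]≡n (<⇒≤ δ<m)))
                                     (shift-walk V (representable L≤c (complement m≤ (≰⇒> δ≰))) (toℕ j)))
                           (adj-sym (edge-0 (toℕ i)))))
  ...   | yes δ≤ with split-range {c = c} (ranges-overlap (s≤s L≤c)) δ≤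
  ...     | inj₁ δ≤cs =
    retarget (⟦toℕ⟧ i) lands (snoc (shift-walk U (representable L≤c δ≤cs) (toℕ i)) (edge-0 _))
  ...     | inj₂ (s≤δ , rest≤) =
    retarget (⟦toℕ⟧ i) lands
             (snoc (shift-walk U (representable L≤c rest≤) (toℕ i)) (edge ≤-refl (cong (_% m) full)))
    where
    full : toℕ i + (δ ∸ s) + s ≡ toℕ i + δ
    full = trans (+-assoc (toℕ i) (δ ∸ s) s) (cong (toℕ i +_) (m∸n+n≡m s≤δ))

  data Near (A B : ℕ) (i : Fin m) : Set where
    ahead  : toℕ i ≤ A → Near A B i
    behind : m ≤ toℕ i + B → Near A B i

  near-cong : ∀ {A A′ B B′ i} → A ≡ A′ → B ≡ B′ → Near A B i → Near A′ B′ i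
  near-cong refl refl near = near

  offset≤s : ∀ {a} → a < suc (suc L) → 2 ^ a ∸ 1 ≤ s
  offset≤s {a} (s≤s a≤k) = subst (_≤ s) (offset≡ a) (offset-mono a≤k)

  near-UV : ∀ {A B i j} → KRel (suc (suc L)) m i j → Near A B i → Near (A + s) B j
  near-UV {A} {B} {i} {j} (a , a<Δ , e) near with mod-step (2 ^ a ∸ 1) (Fin.toℕ<n i)
  ... | inj₁ no-wrap = case near
    where
    j≡ : toℕ j ≡ toℕ i + (2 ^ a ∸ 1)
    j≡ = trans (sym e) no-wrap
    case : Near A B i → Near (A + s) B j
    case (ahead i≤A)    = ahead (≤-trans (≤-reflexive j≡) (+-mono-≤ i≤A (offset≤s a<Δ)))
    case (behind m≤i+B) =
      behind (≤-trans m≤i+B (+-monoˡ-≤ B (≤-trans (m≤m+n (toℕ i) _) (≤-reflexive (sym j≡)))))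
  ... | inj₂ wrap = ahead (≤-trans (<⇒≤ j<t) (≤-trans (offset≤s a<Δ) (m≤n+m s A)))
    where
    j<t : toℕ j < 2 ^ a ∸ 1
    j<t = +-cancelˡ-< m _ _ (begin-strict
      m + toℕ j                ≡⟨ +-comm m (toℕ j) ⟩
      toℕ j + m                ≤⟨ subst (λ r → r + m ≤ _) e wrap ⟩
      toℕ i + (2 ^ a ∸ 1)      <⟨ +-monoˡ-< _ (Fin.toℕ<n i) ⟩
      m + (2 ^ a ∸ 1)          ∎)
      where open ≤-Reasoning

  near-VU : ∀ {A B i j} → KRel (suc (suc L)) m i j → Near A B j → Near A (B + s) i
  near-VU {A} {B} {i} {j} (a , a<Δ , e) near with mod-step (2 ^ a ∸ 1) (Fin.toℕ<n i)
  ... | inj₁ no-wrap = case near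
    where
    j≡ : toℕ j ≡ toℕ i + (2 ^ a ∸ 1)
    j≡ = trans (sym e) no-wrap
    case : Near A B j → Near A (B + s) i
    case (ahead j≤A)    = ahead (≤-trans (m≤m+n (toℕ i) _) (≤-trans (≤-reflexive (sym j≡)) j≤A))
    case (behind m≤j+B) = behind (begin
      m                            ≤⟨ m≤j+B ⟩
      toℕ j + B                    ≡⟨ cong (_+ B) j≡ ⟩
      toℕ i + (2 ^ a ∸ 1) + B      ≡⟨ +-assoc (toℕ i) _ B ⟩
      toℕ i + ((2 ^ a ∸ 1) + B)    ≤⟨ +-monoʳ-≤ (toℕ i) (+-monoˡ-≤ B (offset≤s a<Δ)) ⟩
      toℕ i + (s + B)              ≡⟨ cong (toℕ i +_) (+-comm s B) ⟩
      toℕ i + (B + s)              ∎)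
      where open ≤-Reasoning
  ... | inj₂ wrap = behind (begin
      m                      ≤⟨ m≤n+m m (toℕ j) ⟩
      toℕ j + m              ≤⟨ subst (λ r → r + m ≤ _) e wrap ⟩
      toℕ i + (2 ^ a ∸ 1)    ≤⟨ +-monoʳ-≤ (toℕ i) (≤-trans (offset≤s a<Δ) (m≤n+m s B)) ⟩
      toℕ i + (B + s)        ∎)
    where open ≤-Reasoning

  reach-UU : ∀ {i j n A B} → Walk (suc (suc L)) m (U , i) (U , j) n → Near A B i →
             ∃[ c ] (n ≡ c + c × Near (A + c * s) (B + c * s) j)
  reach-UU {A = A} {B} here near =
    0 , refl , near-cong (sym (+-identityʳ A)) (sym (+-identityʳ B)) near
  reach-UU {A = A} {B} (step (uv r) (step (vu r′) w)) near with reach-UU w (near-VU r′ (near-UV r near))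
  ... | c , refl , near′ = suc c , cong suc (sym (+-suc c c)) ,
                           near-cong (+-assoc A s (c * s)) (+-assoc B s (c * s)) near′

  reach-UV : ∀ {i j n A B} → Walk (suc (suc L)) m (U , i) (V , j) n → Near A B i →
             ∃[ c ] (n ≡ suc (c + c) × Near (A + suc c * s) (B + c * s) j)
  reach-UV {A = A} {B} (step (uv r) here) near =
    0 , refl , near-cong (cong (A +_) (sym (+-identityʳ s))) (sym (+-identityʳ B)) (near-UV r near)
  reach-UV {A = A} {B} (step (uv r) (step (vu r′) w)) near with reach-UV w (near-VU r′ (near-UV r near))
  ... | c , refl , near′ = suc c , cong (suc ∘ suc) (sym (+-suc c c)) ,
                           near-cong (+-assoc A s (suc c * s)) (+-assoc B s (c * s)) near′

-- The diameter formula for Δ = L + 2 ≥ 2, with h = ⌊m/2⌋ and g = ⌊(m+s)/2⌋, under the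
-- size hypothesis 2L·s + 2 ≤ m + s (for Δ ≥ 3 this is (2Δ-5)(2^Δ-2) + 4 ≤ n).
module Diameter (L m : ℕ) .{{_ : NonZero m}} (h g : ℕ)
  (s<m : offset (suc L) < m)
  (large : L * offset (suc L) + L * offset (suc L) + 2 ≤ m + offset (suc L))
  (h-half : IsHalf m h) (g-half : IsHalf (m + offset (suc L)) g) where
  open Walks (suc (suc L)) m
  open Shifts (suc L) m
  open Bounds L m

  h-low : h + h ≤ m
  h-low = proj₁ h-half

  h-high : m ≤ suc (h + h)
  h-high = proj₂ h-half

  g-low : g + g ≤ m + s
  g-low = proj₁ g-half

  g-high : m + s ≤ suc (g + g)
  g-high = proj₂ g-half

  reach-h : Least (λ c → h ≤ c * s)
  reach-h = least (λ c → h ≤? c * s) h (m≤m*n h s)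

  reach-g : Least (λ c → g ≤ suc c * s)
  reach-g = least (λ c → g ≤? suc c * s) g (≤-trans (m≤m*n g s) (m≤n+m _ s))

  c₁ c₂ : ℕ
  c₁ = Least.value reach-h
  c₂ = Least.value reach-g

  -- The size hypothesis makes h and g large enough that c₁, c₂ ≥ L, which is what
  -- the representation theorem needs.
  L≤c₁ : L ≤ c₁
  L≤c₁ = ≮⇒≥ λ c₁<L → m+1+n≰m (suc (h + h) + s) (begin
    suc (h + h) + s + suc s    ≡⟨ regroup h s ⟩
    (h + s) + (h + s) + 2      ≤⟨ +-monoˡ-≤ 2 (+-mono-≤ (h+s≤ c₁<L) (h+s≤ c₁<L)) ⟩
    L * s + L * s + 2          ≤⟨ large ⟩
    m + s                      ≤⟨ +-monoˡ-≤ s h-high ⟩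
    suc (h + h) + s            ∎)
    where
    open ≤-Reasoning
    regroup : ∀ h s → suc (h + h) + s + suc s ≡ (h + s) + (h + s) + 2
    regroup = solve-∀
    h+s≤ : c₁ < L → h + s ≤ L * s
    h+s≤ c₁<L = ≤-trans (+-monoˡ-≤ s (Least.holds reach-h))
                        (≤-trans (≤-reflexive (+-comm (c₁ * s) s)) (*-monoˡ-≤ s c₁<L))

  L≤c₂ : L ≤ c₂
  L≤c₂ = ≮⇒≥ λ c₂<L → m+1+n≰m (suc (g + g)) (begin
    suc (g + g) + 1            ≡⟨ +-comm (suc (g + g)) 1 ⟩
    2 + (g + g)                ≡⟨ +-comm 2 (g + g) ⟩
    g + g + 2                  ≤⟨ +-monoˡ-≤ 2 (+-mono-≤ (g≤ c₂<L) (g≤ c₂<L)) ⟩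
    L * s + L * s + 2          ≤⟨ large ⟩
    m + s                      ≤⟨ g-high ⟩
    suc (g + g)                ∎)
    where
    open ≤-Reasoning
    g≤ : c₂ < L → g ≤ L * s
    g≤ c₂<L = ≤-trans (Least.holds reach-g) (*-monoˡ-≤ s c₂<L)

  cover₁ : m ≤ suc (c₁ * s + c₁ * s)
  cover₁ = ≤-trans h-high (s≤s (+-mono-≤ (Least.holds reach-h) (Least.holds reach-h)))

  cover₂ : m ≤ suc (suc c₂ * s + c₂ * s)
  cover₂ = +-cancelʳ-≤ s m _ (begin
    m + s                            ≤⟨ g-high ⟩
    suc (g + g)                      ≤⟨ s≤s (+-mono-≤ (Least.holds reach-g) (Least.holds reach-g)) ⟩
    suc (suc c₂ * s + suc c₂ * s)    ≡⟨ regroup s (c₂ * s) ⟩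
    suc (suc c₂ * s + c₂ * s) + s    ∎)
    where
    open ≤-Reasoning
    regroup : ∀ s t → suc ((s + t) + (s + t)) ≡ suc ((s + t) + t) + s
    regroup = solve-∀

  all-pairs : ∀ x y → ∃[ n ] (n ≤ (c₁ + c₁) ⊔ suc (c₂ + c₂) × Walk (suc (suc L)) m x y n)
  all-pairs (U , i) (U , j) = _ , m≤m⊔n _ _ , same-side U c₁ L≤c₁ cover₁ i j
  all-pairs (V , i) (V , j) = _ , m≤m⊔n _ _ , same-side V c₁ L≤c₁ cover₁ i j
  all-pairs (U , i) (V , j) = _ , m≤n⊔m _ _ , cross c₂ L≤c₂ cover₂ i j
  all-pairs (V , i) (U , j) = _ , m≤n⊔m _ _ , reverse (cross c₂ L≤c₂ cover₂ j i)

  below-m : ∀ {x} → x + x ≤ m + s → x < m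
  below-m x+x≤ = halve-< (≤-<-trans x+x≤ (+-monoʳ-< m s<m))

  index : ∀ {x} → x + x ≤ m + s → toℕ ⟦ x ⟧ ≡ x
  index {x} x+x≤ = trans (toℕ-⟦⟧ x) (m<n⇒m%n≡m (below-m x+x≤))

  start : Near 0 0 ⟦ 0 ⟧
  start = ahead (≤-trans (≤-reflexive (toℕ-⟦⟧ 0)) (m%n≤m 0 m))

  far-h : ∀ n → Walk (suc (suc L)) m (U , ⟦ 0 ⟧) (U , ⟦ h ⟧) n → c₁ + c₁ ≤ n
  far-h n w with reach-UU w start
  ... | c , refl , near = +-mono-≤ (Least.minimal reach-h c (h≤ near)) (Least.minimal reach-h c (h≤ near))
    where
    h+h≤ : h + h ≤ m + s
    h+h≤ = ≤-trans h-low (m≤m+n m s)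
    h≤ : Near (c * s) (c * s) ⟦ h ⟧ → h ≤ c * s
    h≤ (ahead h≤cs)    = subst (_≤ c * s) (index h+h≤) h≤cs
    h≤ (behind m≤h+cs) =
      +-cancelˡ-≤ h h _ (≤-trans h-low (subst (λ r → m ≤ r + c * s) (index h+h≤) m≤h+cs))

  far-g : ∀ n → Walk (suc (suc L)) m (U , ⟦ 0 ⟧) (V , ⟦ g ⟧) n → suc (c₂ + c₂) ≤ n
  far-g n w with reach-UV w start
  ... | c , refl , near = s≤s (+-mono-≤ (Least.minimal reach-g c (g≤ near)) (Least.minimal reach-g c (g≤ near)))
    where
    g≤ : Near (suc c * s) (c * s) ⟦ g ⟧ → g ≤ suc c * s
    g≤ (ahead g≤)      = subst (_≤ suc c * s) (index g-low) g≤
    g≤ (behind m≤g+cs) = +-cancelˡ-≤ g g _ (begin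
      g + g                ≤⟨ g-low ⟩
      m + s                ≤⟨ +-monoˡ-≤ s (subst (λ r → m ≤ r + c * s) (index g-low) m≤g+cs) ⟩
      g + c * s + s        ≡⟨ regroup g (c * s) s ⟩
      g + suc c * s        ∎)
      where
      open ≤-Reasoning
      regroup : ∀ g t s → g + t + s ≡ g + (s + t)
      regroup = solve-∀

  diameter-formula : ∃[ d₁ ] ∃[ d₂ ]
                       (IsDist (suc (suc L)) m (U , ⟦ 0 ⟧) (U , ⟦ h ⟧) d₁
                     × IsDist (suc (suc L)) m (U , ⟦ 0 ⟧) (V , ⟦ g ⟧) d₂
                     × IsDiam (suc (suc L)) m (d₁ ⊔ d₂))
  diameter-formula = c₁ + c₁ , suc (c₂ + c₂) , dist-h , dist-g , diameter all-pairs dist-h dist-g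
    where
    dist-h : IsDist (suc (suc L)) m (U , ⟦ 0 ⟧) (U , ⟦ h ⟧) (c₁ + c₁)
    dist-h = same-side U c₁ L≤c₁ cover₁ ⟦ 0 ⟧ ⟦ h ⟧ , far-h
    dist-g : IsDist (suc (suc L)) m (U , ⟦ 0 ⟧) (V , ⟦ g ⟧) (suc (c₂ + c₂))
    dist-g = cross c₂ L≤c₂ cover₂ ⟦ 0 ⟧ ⟦ g ⟧ , far-g

top-edge : ∀ k m → 2 ^ suc k ≤ 2 * m → offset k < m
top-edge k m pow≤ = *-cancelˡ-≤ 2 (subst (_≤ 2 * m) (cong (2 *_) (sym (suc-offset k))) pow≤)

size-bound : ∀ j m → (2 * (3 + j) ∸ 5) * (2 ^ (3 + j) ∸ 2) + 4 ≤ 2 * m →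
             suc j * offset (2 + j) + suc j * offset (2 + j) + 2 ≤ m + offset (2 + j)
size-bound j m size≤ = *-cancelˡ-≤ 2 (begin
  2 * (suc j * s + suc j * s + 2)                           ≡⟨ regroup j s ⟩
  suc (j + j) * (s + s) + 4 + 2 * s                         ≡⟨ cong (λ d → d * (s + s) + 4 + 2 * s) width ⟨
  (2 * (3 + j) ∸ 5) * (s + s) + 4 + 2 * s                   ≡⟨ cong (λ e → (2 * (3 + j) ∸ 5) * (e ∸ 2) + 4 + 2 * s)
                                                                    (suc-offset (3 + j)) ⟩
  (2 * (3 + j) ∸ 5) * (2 ^ (3 + j) ∸ 2) + 4 + 2 * s         ≤⟨ +-monoˡ-≤ (2 * s) size≤ ⟩
  2 * m + 2 * s                                             ≡⟨ *-distribˡ-+ 2 m s ⟨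
  2 * (m + s)                                               ∎)
  where
  open ≤-Reasoning
  s = offset (2 + j)
  regroup : ∀ j s → 2 * (suc j * s + suc j * s + 2) ≡ suc (j + j) * (s + s) + 4 + 2 * s
  regroup = solve-∀
  five : ∀ j → 2 * (3 + j) ≡ 5 + suc (j + j)
  five = solve-∀
  width : 2 * (3 + j) ∸ 5 ≡ suc (j + j)
  width = trans (cong (_∸ 5) (five j)) (m+n∸m≡n 5 (suc (j + j)))

mainTheorem15 : (Δ m : ℕ) → .{{_ : NonZero m}} →
    3 ≤ Δ → 2 ^ Δ ≤ 2 * m →
    (2 * Δ ∸ 5) * (2 ^ Δ ∸ 2) + 4 ≤ 2 * m →
    ∃[ d₁ ] ∃[ d₂ ]
      (IsDist Δ m (uₙ m 0) (uₙ m ((2 * m) / 4)) d₁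
      × IsDist Δ m (uₙ m 0) (vₙ m ((2 * m + 2 * (2 ^ (Δ ∸ 1) ∸ 1)) / 4)) d₂
      × IsDiam Δ m (d₁ ⊔ d₂))
mainTheorem15 (suc (suc (suc j))) m (s≤s (s≤s (s≤s z≤n))) pow≤ size≤ =
  Diameter.diameter-formula (suc j) m h g (top-edge k m pow≤) (size-bound j m size≤) (halving m) g-half
  where
  k = suc (suc j)
  h = (2 * m) / 4
  g = (2 * m + 2 * (2 ^ k ∸ 1)) / 4
  doubled : 2 * (m + offset k) ≡ 2 * m + 2 * (2 ^ k ∸ 1)
  doubled = trans (*-distribˡ-+ 2 m (offset k)) (cong (λ t → 2 * m + 2 * t) (offset≡ k))
  g-half : IsHalf (m + offset k) g
  g-half = subst (IsHalf (m + offset k)) (cong (_/ 4) doubled) (halving (m + offset k))
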